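{- Let $a,b,c$ be positive integers such that $Q^{abc}=1+x^a(x+1)^b(1+x+x^2)^c$ is irreducible over $\mathbb{F}_2$. If $(Q^{abc})^*=Q^{abc}$, then there is an integer $n$ with $(a=1,\ b=2^n-1,\ c=2^n)$ or $(a=3,\ b=c=2^n-1)$.
   Context: Here $Q=M_1=1+x+x^2\in\mathbb{F}_2[x]$ and $Q^{abc}:=1+x^a(x+1)^bQ^c$. For $P\in\mathbb{F}_2[x]$, $P^*(x):=x^{\deg P}P(1/x)$ is the reciprocal of $P$; thus $(Q^{abc})^*=x^{a+b+2c}+(x+1)^b(x^2+x+1)^c$. -}

module Defs where

-- Polynomials over F₂ as coefficient lists (lowest degree first), Bool = F₂.
open import Data.Bool using (Bool; true; false; _xor_; _∧_; if_then_else_)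
open import Data.List using (List; []; _∷_; reverse; length)
open import Data.Nat using (ℕ; zero; suc; _∸_; _≤_)
open import Data.Product using (Σ; _×_)
open import Data.Sum using (_⊎_)
open import Relation.Binary.PropositionalEquality using (_≡_)

Poly : Set
Poly = List Bool

norm : Poly → Poly
norm [] = []
norm (a ∷ p) with norm p
... | [] = if a then true ∷ [] else []
... | q ∷ qs = a ∷ q ∷ qs

_≈_ : Poly → Poly → Set
p ≈ q = norm p ≡ norm q

-- degree (degree of the zero polynomial is taken to be 0)
deg : Poly → ℕ
deg p = length (norm p) ∸ 1

_⊕_ : Poly → Poly → Poly
[] ⊕ q = q
(a ∷ p) ⊕ [] = a ∷ p
(a ∷ p) ⊕ (b ∷ q) = (a xor b) ∷ (p ⊕ q)

scale : Bool → Poly → Poly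
scale _ [] = []
scale a (b ∷ q) = (a ∧ b) ∷ scale a q

_⊗_ : Poly → Poly → Poly
[] ⊗ q = []
(a ∷ p) ⊗ q = scale a q ⊕ (false ∷ (p ⊗ q))

infixl 6 _⊕_
infixl 7 _⊗_

one : Poly
one = true ∷ []

X : Poly
X = false ∷ true ∷ []

_^ᵖ_ : Poly → ℕ → Poly
p ^ᵖ zero = one
p ^ᵖ suc n = p ⊗ (p ^ᵖ n)

Q : Poly
Q = true ∷ true ∷ true ∷ []

Qabc : ℕ → ℕ → ℕ → Poly
Qabc a b c = one ⊕ (X ^ᵖ a) ⊗ ((X ⊕ one) ^ᵖ b) ⊗ (Q ^ᵖ c)

-- reciprocal P*(x) = x^{deg P} P(1/x): reverse the coefficient list of the canonical form
reciprocal : Poly → Poly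
reciprocal p = reverse (norm p)

Irreducible : Poly → Set
Irreducible p = (1 ≤ deg p) × (∀ f g → (f ⊗ g) ≈ p → (deg f ≡ 0) ⊎ (deg g ≡ 0))

-- If Q^{abc} = 1 + xᵃ G, with G = (x+1)ᵇ Qᶜ, is self-reciprocal, then comparing it with its
-- reciprocal x^d + G (d = a + b + 2c) gives (1 + xᵃ) G = 1 + x^d. In characteristic 2 the
-- derivative of the left side vanishes at x = 1, so d is even and, writing [n] for n mod 2,
--   [a] x^{a-1} G = (1 + xᵃ) (x+1)^{b-1} Q^{c-1} ([b] Q + [c] (x + 1)).
-- If a is even then so are b and c, and Q^{abc} is a square, which is not irreducible. If a is
-- odd, the x-adic valuations of the two sides force a = 1 or a = 3; as 1 + x³ = (x + 1) Q this
-- leaves (x+1)ᵐ Qⁿ = 1 + x^{m+2n} with m = b + 1 and n = c or c + 1. Differentiating once more,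
-- either m = n = 1, or m and n are even and the identity is a square; by induction m = n = 2ᵗ.

module Submission where

open import Defs
open import Algebra.Bundles using (CommutativeRing)
open import Algebra.Solver.Ring.AlmostCommutativeRing
  using (fromCommutativeRing; _-Raw-AlmostCommutative⟶_)
import Algebra.Solver.Ring
open import Data.Bool using (Bool; true; false; _xor_; _∧_; not)
open import Data.Bool.Properties
  using (xor-comm; xor-assoc; xor-same; xor-identityʳ; ∧-comm; ∧-assoc; ∧-zeroʳ; ∧-idem; ∧-identityʳ;
         ∧-distribˡ-xor; ∧-distribʳ-xor; not-involutive; xor-∧-commutativeRing)
open import Algebra.Properties.CommutativeSemigroup
  (CommutativeRing.+-commutativeSemigroup xor-∧-commutativeRing)
  using () renaming (interchange to xor-interchange)
open import Algebra.Properties.CommutativeSemigroup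
  (CommutativeRing.*-commutativeSemigroup xor-∧-commutativeRing)
  using () renaming (x∙yz≈y∙xz to ∧-swap)
open import Data.Empty using (⊥-elim)
open import Data.List using ([]; _∷_; replicate; _++_; length; reverse)
open import Data.List.Properties using (unfold-reverse; length-reverse)
open import Data.Maybe using (just; nothing)
open import Data.Nat using (ℕ; zero; suc; pred; _+_; _*_; _^_; _∸_; _≤_; _<_; z≤n; s≤s)
open import Data.Nat.Induction using (<-rec)
open import Data.Nat.Properties
  using (+-suc; +-identityʳ; *-identityˡ; *-zeroʳ; *-suc; *-cancelˡ-≡; suc-injective;
         ≤-refl; ≤-trans; ≤-antisym; m≤n+m; n≤1+n; m<m+n)
open import Data.Nat.Tactic.RingSolver using (solve-∀)
open import Data.Product using (Σ; _×_; _,_; proj₁; proj₂)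
open import Data.Sum using (_⊎_; inj₁; inj₂; [_,_]′) renaming (map to ⊎-map)
open import Relation.Binary.Bundles using (Setoid)
open import Relation.Binary.Definitions using (WeaklyDecidable)
open import Relation.Binary.PropositionalEquality
  using (_≡_; _≢_; refl; sym; trans; cong; cong₂; subst; subst₂; module ≡-Reasoning)
import Relation.Binary.Reasoning.Setoid as SetoidReasoning
open import Relation.Nullary using (¬_; contradiction)

coeff : Poly → ℕ → Bool
coeff []      _       = false
coeff (a ∷ p) zero    = a
coeff (a ∷ p) (suc i) = coeff p i

-- Coefficientwise equality: it agrees with _≈_ (see ≋⇒≈ and ≈⇒≋) and is easier to work with.
infix 4 _≋_
record _≋_ (p q : Poly) : Set where
  constructor coeffwise
  field at : ∀ i → coeff p i ≡ coeff q i
open _≋_ public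

≋-refl : ∀ {p} → p ≋ p
≋-refl = coeffwise λ _ → refl

≋-reflexive : ∀ {p q} → p ≡ q → p ≋ q
≋-reflexive refl = ≋-refl

≋-sym : ∀ {p q} → p ≋ q → q ≋ p
≋-sym e = coeffwise λ i → sym (at e i)

≋-trans : ∀ {p q r} → p ≋ q → q ≋ r → p ≋ r
≋-trans e f = coeffwise λ i → trans (at e i) (at f i)

≋-setoid : Setoid _ _
≋-setoid = record
  { Carrier = Poly ; _≈_ = _≋_
  ; isEquivalence = record { refl = ≋-refl ; sym = ≋-sym ; trans = ≋-trans } }

module ≋-Reasoning = SetoidReasoning ≋-setoid

∷-cong : ∀ {a b p q} → a ≡ b → p ≋ q → a ∷ p ≋ b ∷ q
∷-cong a≡b p≋q = coeffwise λ { zero → a≡b ; (suc i) → at p≋q i }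

∷-injective : ∀ {a b p q} → a ∷ p ≋ b ∷ q → a ≡ b × p ≋ q
∷-injective e = at e zero , coeffwise λ i → at e (suc i)

false∷-zero : ∀ {p} → p ≋ [] → false ∷ p ≋ []
false∷-zero e = coeffwise λ { zero → refl ; (suc i) → at e i }

norm≋ : ∀ p → norm p ≋ p
norm≋ []      = ≋-refl
norm≋ (a ∷ p) with norm p | norm≋ p
norm≋ (true  ∷ p) | []     | e = ∷-cong refl e
norm≋ (false ∷ p) | []     | e = coeffwise λ { zero → refl ; (suc i) → at e i }
...               | q ∷ qs | e = ∷-cong refl e

norm-zero : ∀ {p} → p ≋ [] → norm p ≡ []
norm-zero {[]}    e = refl
norm-zero {b ∷ p} e with at e 0
... | refl with norm p | norm-zero {p} (coeffwise λ i → at e (suc i))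
...   | .[] | refl = refl

norm-∷ : ∀ a {p q} → norm p ≡ norm q → norm (a ∷ p) ≡ norm (a ∷ q)
norm-∷ a {p} {q} e with norm p | norm q | e
... | r | .r | refl = refl

≋⇒≈ : ∀ {p q} → p ≋ q → p ≈ q
≋⇒≈ {[]}    e = sym (norm-zero (≋-sym e))
≋⇒≈ {a ∷ p} {[]}    e = norm-zero e
≋⇒≈ {a ∷ p} {b ∷ q} e with ∷-injective e
... | refl , p≋q = norm-∷ a {p} {q} (≋⇒≈ p≋q)

≈⇒≋ : ∀ {p q} → p ≈ q → p ≋ q
≈⇒≋ {p} {q} e = ≋-trans (≋-sym (norm≋ p)) (≋-trans (≋-reflexive e) (norm≋ q))

coeff-⊕ : ∀ p q i → coeff (p ⊕ q) i ≡ coeff p i xor coeff q i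
coeff-⊕ []      q       i       = refl
coeff-⊕ (a ∷ p) []      i       = sym (xor-identityʳ _)
coeff-⊕ (a ∷ p) (b ∷ q) zero    = refl
coeff-⊕ (a ∷ p) (b ∷ q) (suc i) = coeff-⊕ p q i

coeff-scale : ∀ a p i → coeff (scale a p) i ≡ a ∧ coeff p i
coeff-scale a []      i       = sym (∧-zeroʳ a)
coeff-scale a (b ∷ p) zero    = refl
coeff-scale a (b ∷ p) (suc i) = coeff-scale a p i

⊕-cong : ∀ {p p′ q q′} → p ≋ p′ → q ≋ q′ → p ⊕ q ≋ p′ ⊕ q′
⊕-cong {p} {p′} {q} {q′} e f = coeffwise λ i →
  trans (coeff-⊕ p q i) (trans (cong₂ _xor_ (at e i) (at f i)) (sym (coeff-⊕ p′ q′ i)))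

⊕-comm : ∀ p q → p ⊕ q ≋ q ⊕ p
⊕-comm p q = coeffwise λ i →
  trans (coeff-⊕ p q i) (trans (xor-comm (coeff p i) _) (sym (coeff-⊕ q p i)))

⊕-assoc : ∀ p q r → (p ⊕ q) ⊕ r ≋ p ⊕ (q ⊕ r)
⊕-assoc p q r = coeffwise λ i →
  trans (coeff-⊕ (p ⊕ q) r i) (trans (cong (_xor coeff r i) (coeff-⊕ p q i))
  (trans (xor-assoc (coeff p i) _ _) (trans (cong (coeff p i xor_) (sym (coeff-⊕ q r i)))
  (sym (coeff-⊕ p (q ⊕ r) i)))))

⊕-identityʳ : ∀ p → p ⊕ [] ≋ p
⊕-identityʳ p = coeffwise λ i → trans (coeff-⊕ p [] i) (xor-identityʳ _)

⊕-self : ∀ p → p ⊕ p ≋ []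
⊕-self p = coeffwise λ i → trans (coeff-⊕ p p i) (xor-same (coeff p i))

⊕-interchange : ∀ p q r s → (p ⊕ q) ⊕ (r ⊕ s) ≋ (p ⊕ r) ⊕ (q ⊕ s)
⊕-interchange p q r s = coeffwise λ i →
  trans (coeff-⊕ (p ⊕ q) (r ⊕ s) i) (trans (cong₂ _xor_ (coeff-⊕ p q i) (coeff-⊕ r s i))
  (trans (xor-interchange (coeff p i) _ _ _)
  (sym (trans (coeff-⊕ (p ⊕ r) (q ⊕ s) i) (cong₂ _xor_ (coeff-⊕ p r i) (coeff-⊕ q s i))))))

scale-cong : ∀ {a b p q} → a ≡ b → p ≋ q → scale a p ≋ scale b q
scale-cong {a} {b} {p} {q} e f = coeffwise λ i →
  trans (coeff-scale a p i) (trans (cong₂ _∧_ e (at f i)) (sym (coeff-scale b q i)))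

scale-distribˡ : ∀ a p q → scale a (p ⊕ q) ≋ scale a p ⊕ scale a q
scale-distribˡ a p q = coeffwise λ i →
  trans (coeff-scale a (p ⊕ q) i) (trans (cong (a ∧_) (coeff-⊕ p q i))
  (trans (∧-distribˡ-xor a _ _)
  (sym (trans (coeff-⊕ (scale a p) (scale a q) i) (cong₂ _xor_ (coeff-scale a p i) (coeff-scale a q i))))))

scale-distribʳ : ∀ a b p → scale (a xor b) p ≋ scale a p ⊕ scale b p
scale-distribʳ a b p = coeffwise λ i →
  trans (coeff-scale (a xor b) p i) (trans (∧-distribʳ-xor (coeff p i) a b)
  (sym (trans (coeff-⊕ (scale a p) (scale b p) i) (cong₂ _xor_ (coeff-scale a p i) (coeff-scale b p i)))))

scale-scale : ∀ a b p → scale a (scale b p) ≋ scale (a ∧ b) p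
scale-scale a b p = coeffwise λ i →
  trans (coeff-scale a (scale b p) i) (trans (cong (a ∧_) (coeff-scale b p i))
  (trans (sym (∧-assoc a b _)) (sym (coeff-scale (a ∧ b) p i))))

scale-true : ∀ p → scale true p ≋ p
scale-true p = coeffwise (coeff-scale true p)

scale-false : ∀ p → scale false p ≋ []
scale-false p = coeffwise (coeff-scale false p)

⊗-zeroˡ : ∀ {p} q → p ≋ [] → p ⊗ q ≋ []
⊗-zeroˡ {[]}    q e = ≋-refl
⊗-zeroˡ {a ∷ p} q e with at e zero
... | refl = ⊕-cong (scale-false q) (false∷-zero (⊗-zeroˡ {p} q (coeffwise λ i → at e (suc i))))

⊗-zeroʳ : ∀ p → p ⊗ [] ≋ []
⊗-zeroʳ []      = ≋-refl
⊗-zeroʳ (a ∷ p) = false∷-zero (⊗-zeroʳ p)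

⊗-congˡ : ∀ {p p′} q → p ≋ p′ → p ⊗ q ≋ p′ ⊗ q
⊗-congˡ {[]}    q e = ≋-sym (⊗-zeroˡ q (≋-sym e))
⊗-congˡ {a ∷ p} {[]} q e = ⊗-zeroˡ q e
⊗-congˡ {a ∷ p} {b ∷ p′} q e with ∷-injective e
... | refl , f = ⊕-cong ≋-refl (∷-cong refl (⊗-congˡ q f))

⊗-congʳ : ∀ p {q q′} → q ≋ q′ → p ⊗ q ≋ p ⊗ q′
⊗-congʳ []      e = ≋-refl
⊗-congʳ (a ∷ p) e = ⊕-cong (scale-cong refl e) (∷-cong refl (⊗-congʳ p e))

⊗-cong : ∀ {p p′ q q′} → p ≋ p′ → q ≋ q′ → p ⊗ q ≋ p′ ⊗ q′
⊗-cong {p′ = p′} {q} e f = ≋-trans (⊗-congˡ q e) (⊗-congʳ p′ f)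

scale-⊗ : ∀ a p q → scale a p ⊗ q ≋ scale a (p ⊗ q)
scale-⊗ a []      q = ≋-refl
scale-⊗ a (b ∷ p) q = ≋-trans
  (⊕-cong (≋-sym (scale-scale a b q)) (∷-cong (sym (∧-zeroʳ a)) (scale-⊗ a p q)))
  (≋-sym (scale-distribˡ a (scale b q) (false ∷ p ⊗ q)))

⊗-distribʳ : ∀ q p p′ → (p ⊕ p′) ⊗ q ≋ p ⊗ q ⊕ p′ ⊗ q
⊗-distribʳ q []      p′       = ≋-refl
⊗-distribʳ q (a ∷ p) []       = ≋-sym (⊕-identityʳ _)
⊗-distribʳ q (a ∷ p) (b ∷ p′) = ≋-trans
  (⊕-cong (scale-distribʳ a b q) (∷-cong refl (⊗-distribʳ q p p′)))
  (⊕-interchange (scale a q) (scale b q) (false ∷ p ⊗ q) (false ∷ p′ ⊗ q))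

⊗-distribˡ : ∀ p q q′ → p ⊗ (q ⊕ q′) ≋ p ⊗ q ⊕ p ⊗ q′
⊗-distribˡ []      q q′ = ≋-refl
⊗-distribˡ (a ∷ p) q q′ = ≋-trans
  (⊕-cong (scale-distribˡ a q q′) (∷-cong {false} {false xor false} refl (⊗-distribˡ p q q′)))
  (⊕-interchange (scale a q) (scale a q′) (false ∷ p ⊗ q) (false ∷ p ⊗ q′))

false∷-⊗ : ∀ p q → (false ∷ p) ⊗ q ≋ false ∷ (p ⊗ q)
false∷-⊗ p q = ⊕-cong (scale-false q) ≋-refl

⊗-assoc : ∀ p q r → (p ⊗ q) ⊗ r ≋ p ⊗ (q ⊗ r)
⊗-assoc []      q r = ≋-refl
⊗-assoc (a ∷ p) q r = ≋-trans (⊗-distribʳ r (scale a q) (false ∷ p ⊗ q))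
  (⊕-cong (scale-⊗ a q r) (≋-trans (false∷-⊗ (p ⊗ q) r) (∷-cong refl (⊗-assoc p q r))))

⊗-identityˡ : ∀ p → one ⊗ p ≋ p
⊗-identityˡ p = ≋-trans (⊕-cong (scale-true p) (false∷-zero {[]} ≋-refl)) (⊕-identityʳ p)

⊗-∷ʳ : ∀ p b q → p ⊗ (b ∷ q) ≋ scale b p ⊕ (false ∷ p ⊗ q)
⊗-∷ʳ []      b q = ≋-sym (false∷-zero {[]} ≋-refl)
⊗-∷ʳ (a ∷ p) b q = ∷-cong
  (trans (xor-identityʳ (a ∧ b)) (trans (∧-comm a b) (sym (xor-identityʳ (b ∧ a)))))
  (begin
    scale a q ⊕ p ⊗ (b ∷ q)                     ≈⟨ ⊕-cong (≋-refl {scale a q}) (⊗-∷ʳ p b q) ⟩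
    scale a q ⊕ (scale b p ⊕ (false ∷ p ⊗ q))   ≈⟨ ⊕-assoc (scale a q) (scale b p) _ ⟨
    (scale a q ⊕ scale b p) ⊕ (false ∷ p ⊗ q)   ≈⟨ ⊕-cong (⊕-comm (scale a q) (scale b p)) ≋-refl ⟩
    (scale b p ⊕ scale a q) ⊕ (false ∷ p ⊗ q)   ≈⟨ ⊕-assoc (scale b p) (scale a q) _ ⟩
    scale b p ⊕ (scale a q ⊕ (false ∷ p ⊗ q))   ∎)
  where open ≋-Reasoning

⊗-comm : ∀ p q → p ⊗ q ≋ q ⊗ p
⊗-comm []      q = ≋-sym (⊗-zeroʳ q)
⊗-comm (a ∷ p) q = ≋-sym (≋-trans (⊗-∷ʳ q a p) (⊕-cong ≋-refl (∷-cong refl (⊗-comm q p))))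

⊗-identityʳ : ∀ p → p ⊗ one ≋ p
⊗-identityʳ p = ≋-trans (⊗-comm p one) (⊗-identityˡ p)

F₂[x] : CommutativeRing _ _
F₂[x] = record
  { Carrier = Poly ; _≈_ = _≋_ ; _+_ = _⊕_ ; _*_ = _⊗_ ; -_ = λ p → p ; 0# = [] ; 1# = one
  ; isCommutativeRing = record
    { isRing = record
      { +-isAbelianGroup = record
        { isGroup = record
          { isMonoid = record
            { isSemigroup = record
              { isMagma = record { isEquivalence = Setoid.isEquivalence ≋-setoid ; ∙-cong = ⊕-cong }
              ; assoc = ⊕-assoc }
            ; identity = (λ _ → ≋-refl) , ⊕-identityʳ }
          ; inverse = ⊕-self , ⊕-self
          ; ⁻¹-cong = λ e → e }
        ; comm = ⊕-comm }
      ; *-cong = ⊗-cong ; *-assoc = ⊗-assoc ; *-identity = ⊗-identityˡ , ⊗-identityʳ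
      ; distrib = ⊗-distribˡ , ⊗-distribʳ }
    ; *-comm = ⊗-comm } }

C : Bool → Poly
C a = a ∷ []

C-morphism : CommutativeRing.rawRing xor-∧-commutativeRing
               -Raw-AlmostCommutative⟶ fromCommutativeRing F₂[x]
C-morphism = record
  { ⟦_⟧ = C
  ; +-homo = λ _ _ → ≋-refl
  ; *-homo = λ a b → ∷-cong (sym (xor-identityʳ (a ∧ b))) ≋-refl
  ; -‿homo = λ _ → ≋-refl
  ; 0-homo = false∷-zero ≋-refl
  ; 1-homo = ≋-refl }

C-≟ : WeaklyDecidable (λ a b → C a ≋ C b)
C-≟ false false = just ≋-refl
C-≟ true  true  = just ≋-refl
C-≟ _     _     = nothing

-- The solver knows 1 + 1 = 0 because its coefficients live in F₂.
module F₂[x]-Solver =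
  Algebra.Solver.Ring (CommutativeRing.rawRing xor-∧-commutativeRing)
                      (fromCommutativeRing F₂[x]) C-morphism C-≟

open F₂[x]-Solver using (solve; _:+_; _:*_; _:=_; con)

C-false : ∀ {a} → a ≡ false → C a ≋ []
C-false refl = false∷-zero ≋-refl

C-true : ∀ {a} → a ≡ true → C a ≋ one
C-true refl = ≋-refl

C⊗≋scale : ∀ a p → C a ⊗ p ≋ scale a p
C⊗≋scale a p = ≋-trans (⊕-cong (≋-refl {scale a p}) (false∷-zero {[]} ≋-refl)) (⊕-identityʳ (scale a p))

X⊗ : ∀ p → X ⊗ p ≋ false ∷ p
X⊗ p = ≋-trans (false∷-⊗ (true ∷ []) p) (∷-cong refl (⊗-identityˡ p))

∷≋C⊕X⊗ : ∀ a p → a ∷ p ≋ C a ⊕ X ⊗ p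
∷≋C⊕X⊗ a p = ≋-sym (≋-trans (⊕-cong (≋-refl {C a}) (X⊗ p)) (∷-cong (xor-identityʳ a) ≋-refl))

^-cong : ∀ {p q} n → p ≋ q → p ^ᵖ n ≋ q ^ᵖ n
^-cong zero    e = ≋-refl
^-cong (suc n) e = ⊗-cong e (^-cong n e)

^-+ : ∀ p m n → p ^ᵖ (m + n) ≋ p ^ᵖ m ⊗ p ^ᵖ n
^-+ p zero    n = ≋-sym (⊗-identityˡ _)
^-+ p (suc m) n = ≋-trans (⊗-congʳ p (^-+ p m n)) (≋-sym (⊗-assoc p (p ^ᵖ m) (p ^ᵖ n)))

one-^ : ∀ n → one ^ᵖ n ≋ one
one-^ zero    = ≋-refl
one-^ (suc n) = ≋-trans (⊗-identityˡ _) (one-^ n)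

shift : ℕ → Poly → Poly
shift n p = replicate n false ++ p

X^⊗≋shift : ∀ n p → X ^ᵖ n ⊗ p ≋ shift n p
X^⊗≋shift zero    p = ⊗-identityˡ p
X^⊗≋shift (suc n) p =
  ≋-trans (⊗-assoc X (X ^ᵖ n) p) (≋-trans (X⊗ _) (∷-cong refl (X^⊗≋shift n p)))

⊕≋zero⇒≋ : ∀ {p q} → p ⊕ q ≋ [] → p ≋ q
⊕≋zero⇒≋ {p} {q} p⊕q≋0 = begin
  p              ≈⟨ solve 2 (λ p q → p := (p :+ q) :+ q) ≋-refl p q ⟩
  (p ⊕ q) ⊕ q    ≈⟨ ⊕-cong p⊕q≋0 ≋-refl ⟩
  q              ∎
  where open ≋-Reasoning

-- p(x) ↦ p(x²), which in characteristic 2 is p(x)².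
dilate : Poly → Poly
dilate []      = []
dilate (a ∷ p) = a ∷ false ∷ dilate p

square≋dilate : ∀ p → p ⊗ p ≋ dilate p
square≋dilate []      = ≋-refl
square≋dilate (a ∷ p) = begin
  (a ∷ p) ⊗ (a ∷ p)                  ≈⟨ ⊗-cong (∷≋C⊕X⊗ a p) (∷≋C⊕X⊗ a p) ⟩
  (C a ⊕ X ⊗ p) ⊗ (C a ⊕ X ⊗ p)      ≈⟨ solve 3 (λ c x p → (c :+ x :* p) :* (c :+ x :* p)
                                           := c :* c :+ x :* (x :* (p :* p))) ≋-refl (C a) X p ⟩
  C a ⊗ C a ⊕ X ⊗ (X ⊗ (p ⊗ p))      ≈⟨ ⊕-cong (∷-cong (trans (xor-identityʳ _) (∧-idem a)) ≋-refl)
                                           (≋-trans (X⊗ (X ⊗ (p ⊗ p))) (∷-cong refl (≋-trans (X⊗ (p ⊗ p))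
                                             (∷-cong refl (square≋dilate p))))) ⟩
  C a ⊕ (false ∷ false ∷ dilate p)   ≈⟨ ∷-cong (xor-identityʳ a) ≋-refl ⟩
  a ∷ false ∷ dilate p               ∎
  where open ≋-Reasoning

coeff-dilate : ∀ p i → coeff (dilate p) (i + i) ≡ coeff p i
coeff-dilate []      i       = refl
coeff-dilate (a ∷ p) zero    = refl
coeff-dilate (a ∷ p) (suc i) rewrite +-suc i i = coeff-dilate p i

square-injective : ∀ {p q} → p ⊗ p ≋ q ⊗ q → p ≋ q
square-injective {p} {q} e = coeffwise λ i → trans (sym (coeff-dilate p i))
  (trans (at (≋-trans (≋-sym (square≋dilate p)) (≋-trans e (square≋dilate q))) (i + i))
         (coeff-dilate q i))

ev0 : Poly → Bool
ev0 p = coeff p 0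

ev0-⊗ : ∀ p q → ev0 (p ⊗ q) ≡ ev0 p ∧ ev0 q
ev0-⊗ []      q = refl
ev0-⊗ (a ∷ p) q = trans (coeff-⊕ (scale a q) (false ∷ p ⊗ q) 0)
                        (trans (xor-identityʳ _) (coeff-scale a q 0))

ev0-^ : ∀ {p} n → ev0 p ≡ true → ev0 (p ^ᵖ n) ≡ true
ev0-^         zero    e = refl
ev0-^ {p} (suc n) e = trans (ev0-⊗ p (p ^ᵖ n)) (cong₂ _∧_ e (ev0-^ n e))

ev0-X^suc : ∀ n → ev0 (X ^ᵖ suc n) ≡ false
ev0-X^suc n = ev0-⊗ X (X ^ᵖ n)

ev0-1⊕X^suc : ∀ n → ev0 (one ⊕ X ^ᵖ suc n) ≡ true
ev0-1⊕X^suc n = trans (coeff-⊕ one (X ^ᵖ suc n) 0) (cong (true xor_) (ev0-X^suc n))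

ev1 : Poly → Bool
ev1 []      = false
ev1 (a ∷ p) = a xor ev1 p

ev1-zero : ∀ {p} → p ≋ [] → ev1 p ≡ false
ev1-zero {[]}    e = refl
ev1-zero {a ∷ p} e with at e 0
... | refl = ev1-zero {p} (coeffwise λ i → at e (suc i))

ev1-cong : ∀ {p q} → p ≋ q → ev1 p ≡ ev1 q
ev1-cong {[]}    e = sym (ev1-zero (≋-sym e))
ev1-cong {a ∷ p} {[]}    e = ev1-zero e
ev1-cong {a ∷ p} {b ∷ q} e = cong₂ _xor_ (proj₁ (∷-injective e)) (ev1-cong (proj₂ (∷-injective e)))

ev1-⊕ : ∀ p q → ev1 (p ⊕ q) ≡ ev1 p xor ev1 q
ev1-⊕ []      q       = refl
ev1-⊕ (a ∷ p) []      = sym (xor-identityʳ _)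
ev1-⊕ (a ∷ p) (b ∷ q) = trans (cong ((a xor b) xor_) (ev1-⊕ p q)) (xor-interchange a b (ev1 p) (ev1 q))

ev1-scale : ∀ a p → ev1 (scale a p) ≡ a ∧ ev1 p
ev1-scale a []      = sym (∧-zeroʳ a)
ev1-scale a (b ∷ p) = trans (cong ((a ∧ b) xor_) (ev1-scale a p)) (sym (∧-distribˡ-xor a b (ev1 p)))

ev1-⊗ : ∀ p q → ev1 (p ⊗ q) ≡ ev1 p ∧ ev1 q
ev1-⊗ []      q = refl
ev1-⊗ (a ∷ p) q = trans (ev1-⊕ (scale a q) (false ∷ p ⊗ q))
  (trans (cong₂ _xor_ (ev1-scale a q) (ev1-⊗ p q)) (sym (∧-distribʳ-xor (ev1 q) a (ev1 p))))

ev1-C⊗ : ∀ a p → ev1 (C a ⊗ p) ≡ a ∧ ev1 p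
ev1-C⊗ a p = trans (ev1-⊗ (C a) p) (cong (_∧ ev1 p) (xor-identityʳ a))

ev1-X^ : ∀ n → ev1 (X ^ᵖ n) ≡ true
ev1-X^ zero    = refl
ev1-X^ (suc n) = trans (ev1-⊗ X (X ^ᵖ n)) (ev1-X^ n)

ev1-^ : ∀ {p} n → ev1 p ≡ false → ev1 (p ^ᵖ suc n) ≡ false
ev1-^ {p} n e = trans (ev1-⊗ p (p ^ᵖ n)) (cong (_∧ ev1 (p ^ᵖ n)) e)

ev1-1⊕X^ : ∀ n → ev1 (one ⊕ X ^ᵖ n) ≡ false
ev1-1⊕X^ n = trans (ev1-⊕ one (X ^ᵖ n)) (cong (true xor_) (ev1-X^ n))

-- The x-adic valuation

record Valuation (p : Poly) (i : ℕ) : Set where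
  constructor factor
  field
    unit          : Poly
    unit-at-0     : ev0 unit ≡ true
    factorisation : p ≋ X ^ᵖ i ⊗ unit

coeff-shift : ∀ i p → coeff (shift i p) i ≡ ev0 p
coeff-shift zero    p = refl
coeff-shift (suc i) p = coeff-shift i p

valuation-unique : ∀ {p i j} → Valuation p i → Valuation p j → i ≡ j
valuation-unique {p} {i} {j} (factor v v₀ p≋) (factor w w₀ p≋′) =
  shifts-agree i j (≋-trans (≋-sym (X^⊗≋shift i v)) (≋-trans (≋-sym p≋) (≋-trans p≋′ (X^⊗≋shift j w))))
  where
  shifts-agree : ∀ i j → shift i v ≋ shift j w → i ≡ j
  shifts-agree zero    zero    e = refl
  shifts-agree zero    (suc j) e = contradiction (trans (sym v₀) (at e 0)) λ ()
  shifts-agree (suc i) zero    e = contradiction (trans (sym w₀) (sym (at e 0))) λ ()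
  shifts-agree (suc i) (suc j) e = cong suc (shifts-agree i j (proj₂ (∷-injective e)))

valuation-cong : ∀ {p q i} → p ≋ q → Valuation p i → Valuation q i
valuation-cong p≋q (factor v v₀ p≋) = factor v v₀ (≋-trans (≋-sym p≋q) p≋)

valuation-X^⊗ : ∀ i {v} → ev0 v ≡ true → Valuation (X ^ᵖ i ⊗ v) i
valuation-X^⊗ i {v} v₀ = factor v v₀ ≋-refl

valuation-X^ : ∀ n → Valuation (X ^ᵖ n) n
valuation-X^ n = factor one refl (≋-sym (⊗-identityʳ (X ^ᵖ n)))

valuation-unit : ∀ {p} → ev0 p ≡ true → Valuation p 0
valuation-unit {p} p₀ = factor p p₀ (≋-sym (⊗-identityˡ p))

valuation-⊗ : ∀ {p q i j} → Valuation p i → Valuation q j → Valuation (p ⊗ q) (i + j)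
valuation-⊗ {p} {q} {i} {j} (factor v v₀ p≋) (factor w w₀ q≋) =
  factor (v ⊗ w) (trans (ev0-⊗ v w) (cong₂ _∧_ v₀ w₀)) (begin
    p ⊗ q                          ≈⟨ ⊗-cong p≋ q≋ ⟩
    (X ^ᵖ i ⊗ v) ⊗ (X ^ᵖ j ⊗ w)    ≈⟨ solve 4 (λ a b v w → (a :* v) :* (b :* w) := (a :* b) :* (v :* w))
                                        ≋-refl (X ^ᵖ i) (X ^ᵖ j) v w ⟩
    (X ^ᵖ i ⊗ X ^ᵖ j) ⊗ (v ⊗ w)    ≈⟨ ⊗-congˡ (v ⊗ w) (≋-sym (^-+ X i j)) ⟩
    X ^ᵖ (i + j) ⊗ (v ⊗ w)         ∎)
  where open ≋-Reasoning

valuation⇒nonzero : ∀ {p i} → Valuation p i → ¬ p ≋ []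
valuation⇒nonzero {p} {i} (factor v v₀ p≋) p≋0 = contradiction (begin
  true                    ≡⟨ v₀ ⟨
  ev0 v                   ≡⟨ coeff-shift i v ⟨
  coeff (shift i v) i     ≡⟨ at (≋-trans p≋ (X^⊗≋shift i v)) i ⟨
  coeff p i               ≡⟨ at p≋0 i ⟩
  false                   ∎) λ ()
  where open ≡-Reasoning

nonzero⇒valuation : ∀ p → ¬ p ≋ [] → Σ ℕ (Valuation p)
nonzero⇒valuation []           p≉0 = ⊥-elim (p≉0 ≋-refl)
nonzero⇒valuation (true  ∷ p)  p≉0 = 0 , valuation-unit refl
nonzero⇒valuation (false ∷ p)  p≉0 with nonzero⇒valuation p (λ p≋0 → p≉0 (false∷-zero p≋0))
... | i , factor v v₀ p≋ = suc i , factor v v₀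
  (≋-trans (∷-cong refl p≋) (≋-sym (≋-trans (⊗-assoc X (X ^ᵖ i) v) (X⊗ (X ^ᵖ i ⊗ v)))))

≋-zero-stable : ∀ {p} → ¬ ¬ p ≋ [] → p ≋ []
≋-zero-stable {p} ¬¬p≋0 = coeffwise coeff-zero
  where
  coeff-zero : ∀ i → coeff p i ≡ false
  coeff-zero i with coeff p i in eq
  ... | false = refl
  ... | true  = ⊥-elim (¬¬p≋0 λ p≋0 → contradiction (trans (sym eq) (at p≋0 i)) λ ())

⊗-nonzero : ∀ {p q} → ¬ p ≋ [] → ¬ q ≋ [] → ¬ p ⊗ q ≋ []
⊗-nonzero {p} {q} p≉0 q≉0 with nonzero⇒valuation p p≉0 | nonzero⇒valuation q q≉0
... | _ , vp | _ , vq = valuation⇒nonzero (valuation-⊗ vp vq)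

ev0⇒nonzero : ∀ {p} → ev0 p ≡ true → ¬ p ≋ []
ev0⇒nonzero p₀ = valuation⇒nonzero (valuation-unit p₀)

⊗-cancelˡ : ∀ {h p q} → ¬ h ≋ [] → h ⊗ p ≋ h ⊗ q → p ≋ q
⊗-cancelˡ {h} {p} {q} h≉0 hp≋hq = ⊕≋zero⇒≋ (≋-zero-stable λ p⊕q≉0 → ⊗-nonzero h≉0 p⊕q≉0
  (≋-trans (⊗-distribˡ h p q) (≋-trans (⊕-cong hp≋hq ≋-refl) (⊕-self (h ⊗ q)))))

-- The formal derivative

odd : ℕ → Bool
odd zero    = false
odd (suc n) = not (odd n)

odd-+-2* : ∀ m n → odd (m + 2 * n) ≡ odd m
odd-+-2* m zero    = cong odd (+-identityʳ m)
odd-+-2* m (suc n) = begin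
  odd (m + 2 * suc n)            ≡⟨ cong odd (shift-two m n) ⟩
  not (not (odd (m + 2 * n)))    ≡⟨ not-involutive _ ⟩
  odd (m + 2 * n)                ≡⟨ odd-+-2* m n ⟩
  odd m                          ∎
  where
  open ≡-Reasoning
  shift-two : ∀ m n → m + 2 * suc n ≡ suc (suc (m + 2 * n))
  shift-two = solve-∀

even⇒double : ∀ n → odd n ≡ false → Σ ℕ λ k → n ≡ k + k
even⇒double zero          _ = 0 , refl
even⇒double (suc zero)    ()
even⇒double (suc (suc n)) e with even⇒double n (trans (sym (not-involutive _)) e)
... | k , refl = suc k , cong suc (sym (+-suc k k))

deriv : Poly → Poly
deriv []          = []
deriv (a ∷ [])    = []
deriv (a ∷ b ∷ p) = b ∷ false ∷ deriv p

coeff-deriv : ∀ p i → coeff (deriv p) i ≡ odd (suc i) ∧ coeff p (suc i)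
coeff-deriv []          i             = sym (∧-zeroʳ _)
coeff-deriv (a ∷ [])    i             = sym (∧-zeroʳ _)
coeff-deriv (a ∷ b ∷ p) zero          = refl
coeff-deriv (a ∷ b ∷ p) (suc zero)    = refl
coeff-deriv (a ∷ b ∷ p) (suc (suc i)) =
  trans (coeff-deriv p i) (cong (_∧ coeff p (suc i)) (sym (not-involutive _)))

deriv-cong : ∀ {p q} → p ≋ q → deriv p ≋ deriv q
deriv-cong {p} {q} e = coeffwise λ i →
  trans (coeff-deriv p i) (trans (cong (odd (suc i) ∧_) (at e (suc i))) (sym (coeff-deriv q i)))

deriv-⊕ : ∀ p q → deriv (p ⊕ q) ≋ deriv p ⊕ deriv q
deriv-⊕ p q = coeffwise λ i →
  trans (coeff-deriv (p ⊕ q) i) (trans (cong (odd (suc i) ∧_) (coeff-⊕ p q (suc i)))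
  (trans (∧-distribˡ-xor (odd (suc i)) _ _)
  (sym (trans (coeff-⊕ (deriv p) (deriv q) i) (cong₂ _xor_ (coeff-deriv p i) (coeff-deriv q i))))))

deriv-scale : ∀ a p → deriv (scale a p) ≋ scale a (deriv p)
deriv-scale a p = coeffwise λ i →
  trans (coeff-deriv (scale a p) i) (trans (cong (odd (suc i) ∧_) (coeff-scale a p (suc i)))
  (trans (∧-swap (odd (suc i)) a _) (sym (trans (coeff-scale a (deriv p) i) (cong (a ∧_) (coeff-deriv p i))))))

deriv-∷ : ∀ a p → deriv (a ∷ p) ≋ p ⊕ X ⊗ deriv p
deriv-∷ a p = ≋-trans (coeffwise coeffs) (⊕-cong (≋-refl {p}) (≋-sym (X⊗ (deriv p))))
  where
  not-∧≡xor-∧ : ∀ e x → not e ∧ x ≡ x xor (e ∧ x)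
  not-∧≡xor-∧ false x = sym (xor-identityʳ x)
  not-∧≡xor-∧ true  x = sym (xor-same x)
  coeffs : ∀ i → coeff (deriv (a ∷ p)) i ≡ coeff (p ⊕ (false ∷ deriv p)) i
  coeffs zero    = trans (coeff-deriv (a ∷ p) 0) (sym (trans (coeff-⊕ p _ 0) (xor-identityʳ _)))
  coeffs (suc i) = trans (coeff-deriv (a ∷ p) (suc i))
    (trans (not-∧≡xor-∧ (odd (suc i)) (coeff p (suc i)))
    (sym (trans (coeff-⊕ p (false ∷ deriv p) (suc i)) (cong (coeff p (suc i) xor_) (coeff-deriv p i)))))

deriv-⊗ : ∀ p q → deriv (p ⊗ q) ≋ deriv p ⊗ q ⊕ p ⊗ deriv q
deriv-⊗ []      q = ≋-refl
deriv-⊗ (a ∷ p) q = begin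
  deriv (scale a q ⊕ (false ∷ p ⊗ q))
    ≈⟨ deriv-⊕ (scale a q) (false ∷ p ⊗ q) ⟩
  deriv (scale a q) ⊕ deriv (false ∷ p ⊗ q)
    ≈⟨ ⊕-cong (≋-trans (deriv-scale a q) (≋-sym (C⊗≋scale a (deriv q))))
              (≋-trans (deriv-∷ false (p ⊗ q)) (⊕-cong (≋-refl {p ⊗ q}) (⊗-congʳ X (deriv-⊗ p q)))) ⟩
  C a ⊗ deriv q ⊕ (p ⊗ q ⊕ X ⊗ (deriv p ⊗ q ⊕ p ⊗ deriv q))
    ≈⟨ solve 6 (λ c x p q p′ q′ → c :* q′ :+ (p :* q :+ x :* (p′ :* q :+ p :* q′))
                 := (p :+ x :* p′) :* q :+ (c :+ x :* p) :* q′) ≋-refl (C a) X p q (deriv p) (deriv q) ⟩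
  (p ⊕ X ⊗ deriv p) ⊗ q ⊕ (C a ⊕ X ⊗ p) ⊗ deriv q
    ≈⟨ ⊕-cong (⊗-congˡ q (≋-sym (deriv-∷ a p))) (⊗-congˡ (deriv q) (≋-sym (∷≋C⊕X⊗ a p))) ⟩
  deriv (a ∷ p) ⊗ q ⊕ (a ∷ p) ⊗ deriv q ∎
  where open ≋-Reasoning

deriv-^ : ∀ p n → deriv (p ^ᵖ suc n) ≋ C (odd (suc n)) ⊗ (p ^ᵖ n ⊗ deriv p)
deriv-^ p zero    = ≋-trans (deriv-cong (⊗-identityʳ p))
                            (≋-sym (≋-trans (⊗-identityˡ _) (⊗-identityˡ (deriv p))))
deriv-^ p (suc n) = begin
  deriv (p ⊗ p ^ᵖ suc n)
    ≈⟨ deriv-⊗ p (p ^ᵖ suc n) ⟩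
  deriv p ⊗ p ^ᵖ suc n ⊕ p ⊗ deriv (p ^ᵖ suc n)
    ≈⟨ ⊕-cong (≋-refl {deriv p ⊗ p ^ᵖ suc n}) (⊗-congʳ p (deriv-^ p n)) ⟩
  deriv p ⊗ (p ⊗ p ^ᵖ n) ⊕ p ⊗ (C (odd (suc n)) ⊗ (p ^ᵖ n ⊗ deriv p))
    ≈⟨ solve 4 (λ p pⁿ p′ c → p′ :* (p :* pⁿ) :+ p :* (c :* (pⁿ :* p′))
                 := (con true :+ c) :* ((p :* pⁿ) :* p′)) ≋-refl p (p ^ᵖ n) (deriv p) (C (odd (suc n))) ⟩
  C (odd (suc (suc n))) ⊗ (p ^ᵖ suc n ⊗ deriv p) ∎
  where open ≋-Reasoning

deriv-X : deriv X ≋ one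
deriv-X = ∷-cong refl (false∷-zero ≋-refl)

deriv-1⊕X^ : ∀ n → deriv (one ⊕ X ^ᵖ suc n) ≋ C (odd (suc n)) ⊗ X ^ᵖ n
deriv-1⊕X^ n = ≋-trans (deriv-⊕ one (X ^ᵖ suc n))
  (≋-trans (deriv-^ X n) (⊗-congʳ (C (odd (suc n))) (≋-trans (⊗-congʳ (X ^ᵖ n) deriv-X) (⊗-identityʳ (X ^ᵖ n)))))

ev1-deriv-⊗ : ∀ p q → ev1 p ≡ false → ev1 q ≡ false → ev1 (deriv (p ⊗ q)) ≡ false
ev1-deriv-⊗ p q p₁ q₁ = begin
  ev1 (deriv (p ⊗ q))                        ≡⟨ ev1-cong (deriv-⊗ p q) ⟩
  ev1 (deriv p ⊗ q ⊕ p ⊗ deriv q)            ≡⟨ ev1-⊕ (deriv p ⊗ q) (p ⊗ deriv q) ⟩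
  ev1 (deriv p ⊗ q) xor ev1 (p ⊗ deriv q)    ≡⟨ cong₂ _xor_ (ev1-⊗ (deriv p) q) (ev1-⊗ p (deriv q)) ⟩
  ev1 (deriv p) ∧ ev1 q xor ev1 p ∧ ev1 (deriv q)
    ≡⟨ cong₂ (λ x y → ev1 (deriv p) ∧ x xor y ∧ ev1 (deriv q)) q₁ p₁ ⟩
  ev1 (deriv p) ∧ false xor false            ≡⟨ trans (xor-identityʳ _) (∧-zeroʳ (ev1 (deriv p))) ⟩
  false                                      ∎
  where open ≡-Reasoning

-- (p q)′(1) = 0, while (1 + xⁿ)′ = n xⁿ⁻¹: so n is even and the derivative vanishes.
deriv-vanishes : ∀ {p q} n → ev1 p ≡ false → ev1 q ≡ false → p ⊗ q ≋ one ⊕ X ^ᵖ n → deriv (p ⊗ q) ≋ []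
deriv-vanishes zero    _  _  pq≋ = deriv-cong pq≋
deriv-vanishes {p} {q} (suc n) p₁ q₁ pq≋ = ≋-trans (deriv-cong pq≋) (≋-trans (deriv-1⊕X^ n)
  (⊗-zeroˡ {C (odd (suc n))} (X ^ᵖ n) (C-false odd-n≡false)))
  where
  odd-n≡false : odd (suc n) ≡ false
  odd-n≡false = begin
    odd (suc n)                     ≡⟨ ∧-identityʳ _ ⟨
    odd (suc n) ∧ true              ≡⟨ cong (odd (suc n) ∧_) (ev1-X^ n) ⟨
    odd (suc n) ∧ ev1 (X ^ᵖ n)      ≡⟨ ev1-C⊗ (odd (suc n)) (X ^ᵖ n) ⟨
    ev1 (C (odd (suc n)) ⊗ X ^ᵖ n)  ≡⟨ ev1-cong (≋-trans (deriv-cong pq≋) (deriv-1⊕X^ n)) ⟨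
    ev1 (deriv (p ⊗ q))             ≡⟨ ev1-deriv-⊗ p q p₁ q₁ ⟩
    false                           ∎
    where open ≡-Reasoning

-- Reflection and the reciprocal

-- reflect n p = xⁿ p(1/x), meaningful when p has at most n + 1 coefficients.
reflect : ℕ → Poly → Poly
reflect n []      = []
reflect n (a ∷ p) = C a ⊗ X ^ᵖ n ⊕ reflect (pred n) p

reflect-zero : ∀ n {p} → p ≋ [] → reflect n p ≋ []
reflect-zero n {[]}    e = ≋-refl
reflect-zero n {a ∷ p} e with at e 0
... | refl = ⊕-cong (⊗-zeroˡ (X ^ᵖ n) (C-false refl))
                    (reflect-zero (pred n) {p} (coeffwise λ i → at e (suc i)))

reflect-cong : ∀ n {p q} → p ≋ q → reflect n p ≋ reflect n q
reflect-cong n {[]}    e = ≋-sym (reflect-zero n (≋-sym e))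
reflect-cong n {a ∷ p} {[]}    e = reflect-zero n e
reflect-cong n {a ∷ p} {b ∷ q} e with ∷-injective e
... | refl , p≋q = ⊕-cong (≋-refl {C a ⊗ X ^ᵖ n}) (reflect-cong (pred n) p≋q)

reflect-⊕ : ∀ n p q → reflect n (p ⊕ q) ≋ reflect n p ⊕ reflect n q
reflect-⊕ n []      q       = ≋-refl
reflect-⊕ n (a ∷ p) []      = ≋-sym (⊕-identityʳ _)
reflect-⊕ n (a ∷ p) (b ∷ q) = ≋-trans
  (⊕-cong (⊗-distribʳ (X ^ᵖ n) (C a) (C b)) (reflect-⊕ (pred n) p q))
  (⊕-interchange (C a ⊗ X ^ᵖ n) (C b ⊗ X ^ᵖ n) _ _)

reflect-scale : ∀ n a p → reflect n (scale a p) ≋ C a ⊗ reflect n p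
reflect-scale n a []      = ≋-sym (⊗-zeroʳ (C a))
reflect-scale n a (b ∷ p) = begin
  C (a ∧ b) ⊗ X ^ᵖ n ⊕ reflect (pred n) (scale a p)
    ≈⟨ ⊕-cong (⊗-congˡ {C (a ∧ b)} {C a ⊗ C b} (X ^ᵖ n) (∷-cong (sym (xor-identityʳ _)) ≋-refl))
              (reflect-scale (pred n) a p) ⟩
  (C a ⊗ C b) ⊗ X ^ᵖ n ⊕ C a ⊗ reflect (pred n) p
    ≈⟨ solve 4 (λ a b x r → (a :* b) :* x :+ a :* r := a :* (b :* x :+ r)) ≋-refl
         (C a) (C b) (X ^ᵖ n) (reflect (pred n) p) ⟩
  C a ⊗ (C b ⊗ X ^ᵖ n ⊕ reflect (pred n) p) ∎
  where open ≋-Reasoning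

reflect-+ : ∀ k m q → length q ≤ suc m → reflect (k + m) q ≋ X ^ᵖ k ⊗ reflect m q
reflect-+ k m       []      _ = ≋-sym (⊗-zeroʳ (X ^ᵖ k))
reflect-+ k zero    (b ∷ []) _ rewrite +-identityʳ k = ≋-trans (⊕-identityʳ _)
  (≋-trans (solve 2 (λ c x → c :* x := x :* (c :* con true)) ≋-refl (C b) (X ^ᵖ k))
           (⊗-congʳ (X ^ᵖ k) (≋-sym (⊕-identityʳ _))))
reflect-+ k zero    (b ∷ c ∷ q) (s≤s ())
reflect-+ k (suc m) (b ∷ q) (s≤s len) rewrite +-suc k m = begin
  C b ⊗ X ^ᵖ suc (k + m) ⊕ reflect (k + m) q
    ≈⟨ ⊕-cong (⊗-congʳ (C b) (≋-trans (≋-reflexive (cong (X ^ᵖ_) (sym (+-suc k m)))) (^-+ X k (suc m))))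
              (reflect-+ k m q len) ⟩
  C b ⊗ (X ^ᵖ k ⊗ X ^ᵖ suc m) ⊕ X ^ᵖ k ⊗ reflect m q
    ≈⟨ solve 4 (λ c xᵏ xᵐ r → c :* (xᵏ :* xᵐ) :+ xᵏ :* r := xᵏ :* (c :* xᵐ :+ r)) ≋-refl
         (C b) (X ^ᵖ k) (X ^ᵖ suc m) (reflect m q) ⟩
  X ^ᵖ k ⊗ (C b ⊗ X ^ᵖ suc m ⊕ reflect m q) ∎
  where open ≋-Reasoning

length-scale : ∀ a q → length (scale a q) ≡ length q
length-scale a []      = refl
length-scale a (b ∷ q) = cong suc (length-scale a q)

length-⊕ : ∀ {N} p q → length p ≤ N → length q ≤ N → length (p ⊕ q) ≤ N
length-⊕ []      q       _         len-q     = len-q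
length-⊕ (a ∷ p) []      len-p     _         = len-p
length-⊕ (a ∷ p) (b ∷ q) (s≤s len-p) (s≤s len-q) = s≤s (length-⊕ p q len-p len-q)

length-⊗ : ∀ n m p q → length p ≤ suc n → length q ≤ suc m → length (p ⊗ q) ≤ suc (n + m)
length-⊗ n       m []          q _         _     = z≤n
length-⊗ zero    m (a ∷ [])    q _         len-q =
  length-⊕ (scale a q) (false ∷ []) (subst (_≤ suc m) (sym (length-scale a q)) len-q) (s≤s z≤n)
length-⊗ zero    m (a ∷ b ∷ p) q (s≤s ()) _
length-⊗ (suc n) m (a ∷ p)     q (s≤s len-p) len-q = length-⊕ (scale a q) (false ∷ p ⊗ q)
  (subst (_≤ suc (suc n + m)) (sym (length-scale a q)) (≤-trans len-q (s≤s (≤-trans (m≤n+m m n) (n≤1+n _)))))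
  (s≤s (length-⊗ n m p q len-p len-q))

length-^ : ∀ k p n → length p ≤ suc k → length (p ^ᵖ n) ≤ suc (k * n)
length-^ k p zero    _   rewrite *-zeroʳ k = s≤s z≤n
length-^ k p (suc n) len rewrite *-suc k n = length-⊗ k (k * n) p (p ^ᵖ n) len (length-^ k p n len)

reflect-⊗ : ∀ n m p q → length p ≤ suc n → length q ≤ suc m →
            reflect (n + m) (p ⊗ q) ≋ reflect n p ⊗ reflect m q
reflect-⊗ n       m []       q _ _ = ≋-refl
reflect-⊗ zero    m (a ∷ []) q _ len-q = begin
  reflect m (scale a q ⊕ (false ∷ []))
    ≈⟨ reflect-⊕ m (scale a q) (false ∷ []) ⟩
  reflect m (scale a q) ⊕ reflect m (false ∷ [])
    ≈⟨ ⊕-cong (reflect-scale m a q) (reflect-zero m (false∷-zero {[]} ≋-refl)) ⟩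
  C a ⊗ reflect m q ⊕ []
    ≈⟨ ⊕-identityʳ _ ⟩
  C a ⊗ reflect m q
    ≈⟨ solve 2 (λ c r → c :* r := (c :* con true) :* r) ≋-refl (C a) (reflect m q) ⟩
  (C a ⊗ one) ⊗ reflect m q
    ≈⟨ ⊗-congˡ {C a ⊗ one} (reflect m q) (≋-sym (⊕-identityʳ _)) ⟩
  (C a ⊗ one ⊕ []) ⊗ reflect m q ∎
  where open ≋-Reasoning
reflect-⊗ zero    m (a ∷ b ∷ p) q (s≤s ()) _
reflect-⊗ (suc n) m (a ∷ p)  q (s≤s len-p) len-q = begin
  reflect (suc n + m) (scale a q ⊕ (false ∷ p ⊗ q))
    ≈⟨ reflect-⊕ (suc n + m) (scale a q) (false ∷ p ⊗ q) ⟩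
  reflect (suc n + m) (scale a q) ⊕ (C false ⊗ X ^ᵖ (suc n + m) ⊕ reflect (n + m) (p ⊗ q))
    ≈⟨ ⊕-cong (≋-trans (reflect-scale (suc n + m) a q) (⊗-congʳ (C a) (reflect-+ (suc n) m q len-q)))
              (⊕-cong (⊗-zeroˡ (X ^ᵖ (suc n + m)) (C-false refl)) (reflect-⊗ n m p q len-p len-q)) ⟩
  C a ⊗ (X ^ᵖ suc n ⊗ reflect m q) ⊕ reflect n p ⊗ reflect m q
    ≈⟨ solve 4 (λ c x r s → c :* (x :* r) :+ s :* r := (c :* x :+ s) :* r) ≋-refl
         (C a) (X ^ᵖ suc n) (reflect m q) (reflect n p) ⟩
  (C a ⊗ X ^ᵖ suc n ⊕ reflect n p) ⊗ reflect m q ∎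
  where open ≋-Reasoning

reflect-^ : ∀ k p n → length p ≤ suc k → reflect (k * n) (p ^ᵖ n) ≋ reflect k p ^ᵖ n
reflect-^ k p zero    _   rewrite *-zeroʳ k = ≋-refl
reflect-^ k p (suc n) len rewrite *-suc k n =
  ≋-trans (reflect-⊗ k (k * n) p (p ^ᵖ n) len (length-^ k p n len))
          (⊗-congʳ (reflect k p) (reflect-^ k p n len))

length-^₁ : ∀ p n → length p ≤ 2 → length (p ^ᵖ n) ≤ suc n
length-^₁ p n len = subst (λ k → length (p ^ᵖ n) ≤ suc k) (*-identityˡ n) (length-^ 1 p n len)

reflect-^₁ : ∀ p n → length p ≤ 2 → reflect n (p ^ᵖ n) ≋ reflect 1 p ^ᵖ n
reflect-^₁ p n len = subst (λ k → reflect k (p ^ᵖ n) ≋ reflect 1 p ^ᵖ n) (*-identityˡ n) (reflect-^ 1 p n len)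

++-∷[]≋ : ∀ r a → r ++ a ∷ [] ≋ r ⊕ C a ⊗ X ^ᵖ length r
++-∷[]≋ []      a = ≋-sym (⊗-identityʳ (C a))
++-∷[]≋ (b ∷ r) a = ≋-sym (begin
  (b ∷ r) ⊕ C a ⊗ (X ⊗ X ^ᵖ length r)
    ≈⟨ ⊕-cong (≋-refl {b ∷ r})
              (solve 3 (λ c x y → c :* (x :* y) := x :* (c :* y)) ≋-refl (C a) X (X ^ᵖ length r)) ⟩
  (b ∷ r) ⊕ X ⊗ (C a ⊗ X ^ᵖ length r)
    ≈⟨ ⊕-cong (≋-refl {b ∷ r}) (X⊗ _) ⟩
  (b ∷ r) ⊕ (false ∷ C a ⊗ X ^ᵖ length r)
    ≈⟨ ∷-cong (xor-identityʳ b) (≋-sym (++-∷[]≋ r a)) ⟩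
  b ∷ (r ++ a ∷ []) ∎)
  where open ≋-Reasoning

reverse≋reflect : ∀ {n} p → length p ≡ suc n → reverse p ≋ reflect n p
reverse≋reflect (a ∷ p) refl = begin
  reverse (a ∷ p)                             ≡⟨ unfold-reverse a p ⟩
  reverse p ++ a ∷ []                         ≈⟨ ++-∷[]≋ (reverse p) a ⟩
  reverse p ⊕ C a ⊗ X ^ᵖ length (reverse p)   ≡⟨ cong (λ k → reverse p ⊕ C a ⊗ X ^ᵖ k) (length-reverse p) ⟩
  reverse p ⊕ C a ⊗ X ^ᵖ length p             ≈⟨ ⊕-comm (reverse p) _ ⟩
  C a ⊗ X ^ᵖ length p ⊕ reverse p             ≈⟨ ⊕-cong (≋-refl {C a ⊗ X ^ᵖ length p}) (reverse-tail p) ⟩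
  reflect (length p) (a ∷ p)                  ∎
  where
  open ≋-Reasoning
  reverse-tail : ∀ p → reverse p ≋ reflect (pred (length p)) p
  reverse-tail []      = ≋-refl
  reverse-tail (b ∷ p) = reverse≋reflect (b ∷ p) refl

coeff-top : ∀ n p → length p ≤ suc n → coeff p n ≡ ev0 (reflect n p)
coeff-top n       []          _         = refl
coeff-top zero    (a ∷ [])    _         =
  sym (at (≋-trans (⊕-identityʳ (C a ⊗ one)) (⊗-identityʳ (C a))) 0)
coeff-top zero    (a ∷ b ∷ p) (s≤s ())
coeff-top (suc n) (a ∷ p)     (s≤s len) = begin
  coeff p n                                             ≡⟨ coeff-top n p len ⟩
  ev0 (reflect n p)                                     ≡⟨ cong (_xor ev0 (reflect n p)) (sym top-term₀) ⟩
  ev0 (C a ⊗ X ^ᵖ suc n) xor ev0 (reflect n p)          ≡⟨ coeff-⊕ (C a ⊗ X ^ᵖ suc n) (reflect n p) 0 ⟨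
  ev0 (C a ⊗ X ^ᵖ suc n ⊕ reflect n p)                  ∎
  where
  open ≡-Reasoning
  top-term₀ : ev0 (C a ⊗ X ^ᵖ suc n) ≡ false
  top-term₀ = trans (ev0-⊗ (C a) (X ^ᵖ suc n))
    (trans (cong (a ∧_) (ev0-X^suc n)) (∧-zeroʳ a))

length-norm : ∀ p → length (norm p) ≤ length p
length-norm []      = z≤n
length-norm (a ∷ p) with norm p | length-norm p
length-norm (true  ∷ p) | []     | _   = s≤s z≤n
length-norm (false ∷ p) | []     | _   = z≤n
...                     | q ∷ qs | len = s≤s len

coeff⇒length : ∀ p i → coeff p i ≡ true → i < length p
coeff⇒length (a ∷ p) zero    _ = s≤s z≤n
coeff⇒length (a ∷ p) (suc i) e = s≤s (coeff⇒length p i e)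

x+1 : Poly
x+1 = X ⊕ one

G : ℕ → ℕ → Poly
G b c = x+1 ^ᵖ b ⊗ Q ^ᵖ c

Qabc≋1⊕X^⊗G : ∀ a b c → Qabc a b c ≋ one ⊕ X ^ᵖ a ⊗ G b c
Qabc≋1⊕X^⊗G a b c = ⊕-cong (≋-refl {one}) (⊗-assoc (X ^ᵖ a) (x+1 ^ᵖ b) (Q ^ᵖ c))

length-X^⊗x+1^ : ∀ a b → length (X ^ᵖ a ⊗ x+1 ^ᵖ b) ≤ suc (a + b)
length-X^⊗x+1^ a b = length-⊗ a b (X ^ᵖ a) (x+1 ^ᵖ b) (length-^₁ X a ≤-refl) (length-^₁ x+1 b ≤-refl)

length-Qabc : ∀ a b c → length (Qabc a b c) ≤ suc (a + b + 2 * c)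
length-Qabc a b c = length-⊕ one (X ^ᵖ a ⊗ x+1 ^ᵖ b ⊗ Q ^ᵖ c) (s≤s z≤n)
  (length-⊗ (a + b) (2 * c) (X ^ᵖ a ⊗ x+1 ^ᵖ b) (Q ^ᵖ c)
            (length-X^⊗x+1^ a b) (length-^ 2 Q c ≤-refl))

-- x + 1 and Q are palindromes, and reflecting xᵃ leaves 1.
reflect-Qabc : ∀ a b c → reflect (a + b + 2 * c) (Qabc a b c) ≋ X ^ᵖ (a + b + 2 * c) ⊕ G b c
reflect-Qabc a b c = begin
  reflect (a + b + 2 * c) (one ⊕ X ^ᵖ a ⊗ x+1 ^ᵖ b ⊗ Q ^ᵖ c)
    ≈⟨ reflect-⊕ (a + b + 2 * c) one (X ^ᵖ a ⊗ x+1 ^ᵖ b ⊗ Q ^ᵖ c) ⟩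
  reflect (a + b + 2 * c) one ⊕ reflect (a + b + 2 * c) (X ^ᵖ a ⊗ x+1 ^ᵖ b ⊗ Q ^ᵖ c)
    ≈⟨ ⊕-cong (≋-trans (⊕-identityʳ _) (⊗-identityˡ _))
              (reflect-⊗ (a + b) (2 * c) (X ^ᵖ a ⊗ x+1 ^ᵖ b) (Q ^ᵖ c)
                         (length-X^⊗x+1^ a b) (length-^ 2 Q c ≤-refl)) ⟩
  X ^ᵖ (a + b + 2 * c) ⊕ reflect (a + b) (X ^ᵖ a ⊗ x+1 ^ᵖ b) ⊗ reflect (2 * c) (Q ^ᵖ c)
    ≈⟨ ⊕-cong (≋-refl {X ^ᵖ (a + b + 2 * c)})
              (⊗-cong (reflect-⊗ a b (X ^ᵖ a) (x+1 ^ᵖ b) (length-^₁ X a ≤-refl) (length-^₁ x+1 b ≤-refl))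
                      (reflect-^ 2 Q c ≤-refl)) ⟩
  X ^ᵖ (a + b + 2 * c) ⊕ (reflect a (X ^ᵖ a) ⊗ reflect b (x+1 ^ᵖ b)) ⊗ reflect 2 Q ^ᵖ c
    ≈⟨ ⊕-cong (≋-refl {X ^ᵖ (a + b + 2 * c)})
              (⊗-cong (⊗-cong (≋-trans (reflect-^₁ X a ≤-refl) (≋-trans (^-cong a (≈⇒≋ refl)) (one-^ a)))
                              (≋-trans (reflect-^₁ x+1 b ≤-refl) (^-cong b (≈⇒≋ refl))))
                      (^-cong c (≈⇒≋ refl))) ⟩
  X ^ᵖ (a + b + 2 * c) ⊕ (one ⊗ x+1 ^ᵖ b) ⊗ Q ^ᵖ c
    ≈⟨ ⊕-cong (≋-refl {X ^ᵖ (a + b + 2 * c)}) (⊗-congˡ (Q ^ᵖ c) (⊗-identityˡ (x+1 ^ᵖ b))) ⟩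
  X ^ᵖ (a + b + 2 * c) ⊕ G b c ∎
  where open ≋-Reasoning

ev0-G : ∀ b c → ev0 (G b c) ≡ true
ev0-G b c = trans (ev0-⊗ (x+1 ^ᵖ b) (Q ^ᵖ c)) (cong₂ _∧_ (ev0-^ b refl) (ev0-^ c refl))

top-coeff-Qabc : ∀ a b c → 1 ≤ a → coeff (Qabc a b c) (a + b + 2 * c) ≡ true
top-coeff-Qabc (suc a) b c _ = begin
  coeff (Qabc (suc a) b c) (suc a + b + 2 * c)
    ≡⟨ coeff-top (suc a + b + 2 * c) (Qabc (suc a) b c) (length-Qabc (suc a) b c) ⟩
  ev0 (reflect (suc a + b + 2 * c) (Qabc (suc a) b c))
    ≡⟨ at (reflect-Qabc (suc a) b c) 0 ⟩
  ev0 (X ^ᵖ suc (a + b + 2 * c) ⊕ G b c)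
    ≡⟨ coeff-⊕ (X ^ᵖ suc (a + b + 2 * c)) (G b c) 0 ⟩
  ev0 (X ^ᵖ suc (a + b + 2 * c)) xor ev0 (G b c)
    ≡⟨ cong₂ _xor_ (ev0-X^suc (a + b + 2 * c)) (ev0-G b c) ⟩
  true ∎
  where open ≡-Reasoning

length-norm-Qabc : ∀ a b c → 1 ≤ a → length (norm (Qabc a b c)) ≡ suc (a + b + 2 * c)
length-norm-Qabc a b c 1≤a = ≤-antisym
  (≤-trans (length-norm (Qabc a b c)) (length-Qabc a b c))
  (coeff⇒length (norm (Qabc a b c)) (a + b + 2 * c)
    (trans (at (norm≋ (Qabc a b c)) (a + b + 2 * c)) (top-coeff-Qabc a b c 1≤a)))

deg-Qabc : ∀ a b c → 1 ≤ a → deg (Qabc a b c) ≡ a + b + 2 * c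
deg-Qabc a b c 1≤a = cong pred (length-norm-Qabc a b c 1≤a)

reciprocal-Qabc : ∀ a b c → 1 ≤ a → reciprocal (Qabc a b c) ≋ X ^ᵖ (a + b + 2 * c) ⊕ G b c
reciprocal-Qabc a b c 1≤a = begin
  reverse (norm (Qabc a b c))
    ≈⟨ reverse≋reflect (norm (Qabc a b c)) (length-norm-Qabc a b c 1≤a) ⟩
  reflect (a + b + 2 * c) (norm (Qabc a b c))
    ≈⟨ reflect-cong (a + b + 2 * c) (norm≋ (Qabc a b c)) ⟩
  reflect (a + b + 2 * c) (Qabc a b c)
    ≈⟨ reflect-Qabc a b c ⟩
  X ^ᵖ (a + b + 2 * c) ⊕ G b c ∎
  where open ≋-Reasoning

self-reciprocal-Qabc : ∀ a b c → 1 ≤ a → reciprocal (Qabc a b c) ≈ Qabc a b c →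
                       (one ⊕ X ^ᵖ a) ⊗ G b c ≋ one ⊕ X ^ᵖ (a + b + 2 * c)
self-reciprocal-Qabc a b c 1≤a self = begin
  (one ⊕ X ^ᵖ a) ⊗ G b c
    ≈⟨ solve 3 (λ y g x → (con true :+ y) :* g := (x :+ g) :+ (x :+ y :* g)) ≋-refl
         (X ^ᵖ a) (G b c) (X ^ᵖ (a + b + 2 * c)) ⟩
  (X ^ᵖ (a + b + 2 * c) ⊕ G b c) ⊕ (X ^ᵖ (a + b + 2 * c) ⊕ X ^ᵖ a ⊗ G b c)
    ≈⟨ ⊕-cong (≋-trans (≋-sym (reciprocal-Qabc a b c 1≤a))
                       (≋-trans (≈⇒≋ self) (Qabc≋1⊕X^⊗G a b c))) ≋-refl ⟩
  (one ⊕ X ^ᵖ a ⊗ G b c) ⊕ (X ^ᵖ (a + b + 2 * c) ⊕ X ^ᵖ a ⊗ G b c)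
    ≈⟨ solve 3 (λ y x g → (con true :+ y :* g) :+ (x :+ y :* g) := con true :+ x) ≋-refl
         (X ^ᵖ a) (X ^ᵖ (a + b + 2 * c)) (G b c) ⟩
  one ⊕ X ^ᵖ (a + b + 2 * c) ∎
  where open ≋-Reasoning

Qabc-double : ∀ a b c → Qabc (a + a) (b + b) (c + c) ≋ Qabc a b c ⊗ Qabc a b c
Qabc-double a b c = begin
  one ⊕ X ^ᵖ (a + a) ⊗ x+1 ^ᵖ (b + b) ⊗ Q ^ᵖ (c + c)
    ≈⟨ ⊕-cong (≋-refl {one}) (⊗-cong (⊗-cong (^-+ X a a) (^-+ x+1 b b)) (^-+ Q c c)) ⟩
  one ⊕ (X ^ᵖ a ⊗ X ^ᵖ a) ⊗ (x+1 ^ᵖ b ⊗ x+1 ^ᵖ b) ⊗ (Q ^ᵖ c ⊗ Q ^ᵖ c)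
    ≈⟨ solve 3 (λ x u q → con true :+ (x :* x) :* (u :* u) :* (q :* q)
                 := (con true :+ x :* u :* q) :* (con true :+ x :* u :* q))
         ≋-refl (X ^ᵖ a) (x+1 ^ᵖ b) (Q ^ᵖ c) ⟩
  Qabc a b c ⊗ Qabc a b c ∎
  where open ≋-Reasoning

AllEven : ℕ → ℕ → ℕ → Set
AllEven a b c = odd a ≡ false × odd b ≡ false × odd c ≡ false

all-even⇒reducible : ∀ a b c → 1 ≤ a → AllEven a b c → ¬ Irreducible (Qabc a b c)
all-even⇒reducible a b c 1≤a (odd-a , odd-b , odd-c) (_ , irreducible)
  with even⇒double a odd-a | even⇒double b odd-b | even⇒double c odd-c
all-even⇒reducible _ b c () _ _ | zero , refl | _ | _
... | suc k , refl | l , refl | m , refl =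
  [ degree-positive , degree-positive ]′
    (irreducible (Qabc (suc k) l m) (Qabc (suc k) l m) (≋⇒≈ (≋-sym (Qabc-double (suc k) l m))))
  where
  degree-positive : deg (Qabc (suc k) l m) ≢ 0
  degree-positive deg≡0 = contradiction (trans (sym (deg-Qabc (suc k) l m (s≤s z≤n))) deg≡0) λ ()

-- β and γ stand for b + 1 and c + 1 modulo 2, see deriv-G.
W : Bool → Bool → Poly
W β γ = C β ⊗ Q ⊕ C γ ⊗ x+1

deriv-x+1 : deriv x+1 ≋ one
deriv-x+1 = ∷-cong refl (false∷-zero ≋-refl)

deriv-Q : deriv Q ≋ one
deriv-Q = ∷-cong refl (false∷-zero ≋-refl)

deriv-G : ∀ b c → deriv (G (suc b) (suc c)) ≋ G b c ⊗ W (odd (suc b)) (odd (suc c))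
deriv-G b c = begin
  deriv (x+1 ^ᵖ suc b ⊗ Q ^ᵖ suc c)
    ≈⟨ deriv-⊗ (x+1 ^ᵖ suc b) (Q ^ᵖ suc c) ⟩
  deriv (x+1 ^ᵖ suc b) ⊗ Q ^ᵖ suc c ⊕ x+1 ^ᵖ suc b ⊗ deriv (Q ^ᵖ suc c)
    ≈⟨ ⊕-cong (⊗-congˡ (Q ^ᵖ suc c) (deriv-^ x+1 b)) (⊗-congʳ (x+1 ^ᵖ suc b) (deriv-^ Q c)) ⟩
  C β ⊗ (x+1 ^ᵖ b ⊗ deriv x+1) ⊗ Q ^ᵖ suc c ⊕ x+1 ^ᵖ suc b ⊗ (C γ ⊗ (Q ^ᵖ c ⊗ deriv Q))
    ≈⟨ ⊕-cong (⊗-congˡ (Q ^ᵖ suc c) (⊗-congʳ (C β) (⊗-congʳ (x+1 ^ᵖ b) deriv-x+1)))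
              (⊗-congʳ (x+1 ^ᵖ suc b) (⊗-congʳ (C γ) (⊗-congʳ (Q ^ᵖ c) deriv-Q))) ⟩
  C β ⊗ (x+1 ^ᵖ b ⊗ one) ⊗ (Q ⊗ Q ^ᵖ c) ⊕ (x+1 ⊗ x+1 ^ᵖ b) ⊗ (C γ ⊗ (Q ^ᵖ c ⊗ one))
    ≈⟨ solve 6 (λ Cβ Cγ u q uᵇ qᶜ → Cβ :* (uᵇ :* con true) :* (q :* qᶜ) :+ (u :* uᵇ) :* (Cγ :* (qᶜ :* con true))
                 := (uᵇ :* qᶜ) :* (Cβ :* q :+ Cγ :* u))
         ≋-refl (C β) (C γ) x+1 Q (x+1 ^ᵖ b) (Q ^ᵖ c) ⟩
  G b c ⊗ W β γ ∎
  where
  open ≋-Reasoning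
  β = odd (suc b)
  γ = odd (suc c)

G-suc : ∀ b c → G (suc b) (suc c) ≋ G b c ⊗ (x+1 ⊗ Q)
G-suc b c = solve 4 (λ u q uᵇ qᶜ → (u :* uᵇ) :* (q :* qᶜ) := (uᵇ :* qᶜ) :* (u :* q)) ≋-refl
  x+1 Q (x+1 ^ᵖ b) (Q ^ᵖ c)

W-zero : ∀ {β γ} → W β γ ≋ [] → β ≡ false × γ ≡ false
W-zero {false} {false} _ = refl , refl
W-zero {false} {true}  e = contradiction (at e 0) λ ()
W-zero {true}  {false} e = contradiction (at e 0) λ ()
W-zero {true}  {true}  e = contradiction (at e 2) λ ()

⊗W-zero : ∀ {h β γ} → ev0 h ≡ true → h ⊗ W β γ ≋ [] → β ≡ false × γ ≡ false
⊗W-zero {h} h₀ hW≋0 = W-zero (≋-zero-stable λ W≉0 → ⊗-nonzero (ev0⇒nonzero {h} h₀) W≉0 hW≋0)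

valuation-W : ∀ β γ → ¬ W β γ ≋ [] → Valuation (W β γ) 0 ⊎ Valuation (W β γ) 2
valuation-W false false W≉0 = ⊥-elim (W≉0 (≈⇒≋ refl))
valuation-W false true  _   = inj₁ (valuation-unit refl)
valuation-W true  false _   = inj₁ (valuation-unit refl)
valuation-W true  true  _   = inj₂ (factor one refl (≈⇒≋ refl))

ev1-G : ∀ b c → ev1 (G (suc b) c) ≡ false
ev1-G b c = trans (ev1-⊗ (x+1 ^ᵖ suc b) (Q ^ᵖ c)) (cong (_∧ ev1 (Q ^ᵖ c)) (ev1-^ {x+1} b refl))

deriv-1⊕X^⊗G : ∀ a b c → deriv ((one ⊕ X ^ᵖ suc a) ⊗ G (suc b) (suc c)) ≋
  C (odd (suc a)) ⊗ X ^ᵖ a ⊗ G (suc b) (suc c)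
    ⊕ (one ⊕ X ^ᵖ suc a) ⊗ (G b c ⊗ W (odd (suc b)) (odd (suc c)))
deriv-1⊕X^⊗G a b c = ≋-trans (deriv-⊗ (one ⊕ X ^ᵖ suc a) (G (suc b) (suc c)))
  (⊕-cong (⊗-congˡ (G (suc b) (suc c)) (deriv-1⊕X^ a)) (⊗-congʳ (one ⊕ X ^ᵖ suc a) (deriv-G b c)))

deriv-identity : ∀ a b c n → (one ⊕ X ^ᵖ suc a) ⊗ G (suc b) (suc c) ≋ one ⊕ X ^ᵖ n →
  C (odd (suc a)) ⊗ X ^ᵖ a ⊗ G (suc b) (suc c)
    ≋ (one ⊕ X ^ᵖ suc a) ⊗ (G b c ⊗ W (odd (suc b)) (odd (suc c)))
deriv-identity a b c n e = ⊕≋zero⇒≋ (≋-trans (≋-sym (deriv-1⊕X^⊗G a b c))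
  (deriv-vanishes {one ⊕ X ^ᵖ suc a} {G (suc b) (suc c)} n (ev1-1⊕X^ (suc a)) (ev1-G b (suc c)) e))

-- Compare x-adic valuations: a on the left, 0 or 2 on the right.
odd-a-cases : ∀ a β γ → X ^ᵖ a ⊗ (x+1 ⊗ Q) ≋ (one ⊕ X ^ᵖ suc a) ⊗ W β γ → a ≡ 0 ⊎ a ≡ 2
odd-a-cases a β γ e = ⊎-map valuation-of-W valuation-of-W (valuation-W β γ W≉0)
  where
  lhs : Valuation (X ^ᵖ a ⊗ (x+1 ⊗ Q)) a
  lhs = valuation-X^⊗ a refl
  valuation-of-W : ∀ {k} → Valuation (W β γ) k → a ≡ k
  valuation-of-W v = valuation-unique lhs
    (valuation-cong (≋-sym e) (valuation-⊗ (valuation-unit {one ⊕ X ^ᵖ suc a} (ev0-1⊕X^suc a)) v))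
  W≉0 : ¬ W β γ ≋ []
  W≉0 W≋0 = valuation⇒nonzero lhs
    (≋-trans e (≋-trans (⊗-congʳ (one ⊕ X ^ᵖ suc a) W≋0) (⊗-zeroʳ (one ⊕ X ^ᵖ suc a))))

self-reciprocal-cases : ∀ a b c n → (one ⊕ X ^ᵖ suc a) ⊗ G (suc b) (suc c) ≋ one ⊕ X ^ᵖ n →
                        AllEven (suc a) (suc b) (suc c) ⊎ (a ≡ 0 ⊎ a ≡ 2)
self-reciprocal-cases a b c n e = by-parity-of-a (odd (suc a)) refl
  where
  open ≋-Reasoning
  L = one ⊕ X ^ᵖ suc a
  W′ = W (odd (suc b)) (odd (suc c))
  by-parity-of-a : ∀ α → odd (suc a) ≡ α → AllEven (suc a) (suc b) (suc c) ⊎ (a ≡ 0 ⊎ a ≡ 2)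
  by-parity-of-a false odd-a = inj₁ (odd-a , ⊗W-zero {L ⊗ G b c}
    (trans (ev0-⊗ L (G b c)) (cong₂ _∧_ (ev0-1⊕X^suc a) (ev0-G b c)))
    (begin
      L ⊗ G b c ⊗ W′                                 ≈⟨ ⊗-assoc L (G b c) W′ ⟩
      L ⊗ (G b c ⊗ W′)                               ≈⟨ deriv-identity a b c n e ⟨
      C (odd (suc a)) ⊗ X ^ᵖ a ⊗ G (suc b) (suc c)   ≈⟨ ⊗-zeroˡ (G (suc b) (suc c))
                                                           (⊗-zeroˡ (X ^ᵖ a) (C-false odd-a)) ⟩
      []                                             ∎))
  by-parity-of-a true  odd-a = inj₂ (odd-a-cases a (odd (suc b)) (odd (suc c))
    (⊗-cancelˡ (ev0⇒nonzero {G b c} (ev0-G b c)) (begin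
      G b c ⊗ (X ^ᵖ a ⊗ (x+1 ⊗ Q))                   ≈⟨ solve 3 (λ g x h → g :* (x :* h)
                                                                 := (con true :* x) :* (g :* h))
                                                           ≋-refl (G b c) (X ^ᵖ a) (x+1 ⊗ Q) ⟩
      one ⊗ X ^ᵖ a ⊗ (G b c ⊗ (x+1 ⊗ Q))             ≈⟨ ⊗-cong (⊗-congˡ (X ^ᵖ a) (C-true odd-a)) (G-suc b c) ⟨
      C (odd (suc a)) ⊗ X ^ᵖ a ⊗ G (suc b) (suc c)   ≈⟨ deriv-identity a b c n e ⟩
      L ⊗ (G b c ⊗ W′)                               ≈⟨ solve 3 (λ l g w → l :* (g :* w) := g :* (l :* w))
                                                           ≋-refl L (G b c) W′ ⟩
      G b c ⊗ (L ⊗ W′)                               ∎)))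

-- The identity (x+1)ᵐ Qⁿ = 1 + x^{m+2n}

SamePowerOfTwo : ℕ → ℕ → Set
SamePowerOfTwo m n = Σ ℕ λ t → m ≡ 2 ^ t × n ≡ 2 ^ t

double-power : ∀ {k} t → k ≡ 2 ^ t → k + k ≡ 2 ^ suc t
double-power t refl = cong (2 ^ t +_) (sym (+-identityʳ (2 ^ t)))

halve-exponents : ∀ k l → G (k + k) (l + l) ≋ one ⊕ X ^ᵖ (k + k + 2 * (l + l)) →
                  G k l ≋ one ⊕ X ^ᵖ (k + 2 * l)
halve-exponents k l e = square-injective (begin
  G k l ⊗ G k l
    ≈⟨ solve 2 (λ u q → (u :* q) :* (u :* q) := (u :* u) :* (q :* q)) ≋-refl (x+1 ^ᵖ k) (Q ^ᵖ l) ⟩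
  (x+1 ^ᵖ k ⊗ x+1 ^ᵖ k) ⊗ (Q ^ᵖ l ⊗ Q ^ᵖ l)
    ≈⟨ ⊗-cong (^-+ x+1 k k) (^-+ Q l l) ⟨
  G (k + k) (l + l)
    ≈⟨ e ⟩
  one ⊕ X ^ᵖ (k + k + 2 * (l + l))
    ≡⟨ cong (λ N → one ⊕ X ^ᵖ N) (regroup k l) ⟩
  one ⊕ X ^ᵖ (k + 2 * l + (k + 2 * l))
    ≈⟨ ⊕-cong (≋-refl {one}) (^-+ X (k + 2 * l) (k + 2 * l)) ⟩
  one ⊕ X ^ᵖ (k + 2 * l) ⊗ X ^ᵖ (k + 2 * l)
    ≈⟨ solve 1 (λ y → con true :+ y :* y := (con true :+ y) :* (con true :+ y)) ≋-refl (X ^ᵖ (k + 2 * l)) ⟩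
  (one ⊕ X ^ᵖ (k + 2 * l)) ⊗ (one ⊕ X ^ᵖ (k + 2 * l)) ∎)
  where
  open ≋-Reasoning
  regroup : ∀ k l → k + k + 2 * (l + l) ≡ k + 2 * l + (k + 2 * l)
  regroup = solve-∀

-- At x = 1 the left side vanishes unless m = 0; then compare x-adic valuations.
powers-of-two-odd-case : ∀ m n → G m n ⊗ W true (odd (suc n)) ≋ C true ⊗ X ^ᵖ (m + 2 * suc n) →
                         m ≡ 0 × n ≡ 0
powers-of-two-odd-case (suc m) n e = contradiction (begin
  false                                               ≡⟨ cong (_∧ ev1 W′) (ev1-G m n) ⟨
  ev1 (G (suc m) n) ∧ ev1 W′                          ≡⟨ ev1-⊗ (G (suc m) n) W′ ⟨
  ev1 (G (suc m) n ⊗ W′)                              ≡⟨ ev1-cong e ⟩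
  ev1 (C true ⊗ X ^ᵖ (suc m + 2 * suc n))             ≡⟨ ev1-C⊗ true (X ^ᵖ (suc m + 2 * suc n)) ⟩
  ev1 (X ^ᵖ (suc m + 2 * suc n))                      ≡⟨ ev1-X^ (suc m + 2 * suc n) ⟩
  true                                                ∎) λ ()
  where
  open ≡-Reasoning
  W′ = W true (odd (suc n))
powers-of-two-odd-case zero n e =
  refl , from-valuation (valuation-W true (odd (suc n)) λ W≋0 → contradiction (proj₁ (W-zero W≋0)) λ ())
  where
  rhs : Valuation (G 0 n ⊗ W true (odd (suc n))) (2 * suc n)
  rhs = valuation-cong (≋-sym (≋-trans e (⊗-identityˡ (X ^ᵖ (2 * suc n))))) (valuation-X^ (2 * suc n))
  valuation-of-W : ∀ {k} → Valuation (W true (odd (suc n))) k → 2 * suc n ≡ k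
  valuation-of-W v = valuation-unique rhs (valuation-⊗ (valuation-unit {G 0 n} (ev0-G 0 n)) v)
  from-valuation : Valuation (W true (odd (suc n))) 0 ⊎ Valuation (W true (odd (suc n))) 2 → n ≡ 0
  from-valuation (inj₁ v) = contradiction (valuation-of-W v) λ ()
  from-valuation (inj₂ v) = suc-injective (*-cancelˡ-≡ (suc n) 1 2 (valuation-of-W v))

powers-of-two : ∀ m n → 1 ≤ m → 1 ≤ n → G m n ≋ one ⊕ X ^ᵖ (m + 2 * n) → SamePowerOfTwo m n
powers-of-two = <-rec _ step
  where
  Claim : ℕ → Set
  Claim m = ∀ n → 1 ≤ m → 1 ≤ n → G m n ≋ one ⊕ X ^ᵖ (m + 2 * n) → SamePowerOfTwo m n
  step : ∀ m → (∀ {k} → k < m → Claim k) → Claim m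
  step (suc m) rec (suc n) _ _ e = by-parity-of-m (odd (suc m)) refl
    where
    open ≋-Reasoning
    derivative : G m n ⊗ W (odd (suc m)) (odd (suc n)) ≋ C (odd (suc m)) ⊗ X ^ᵖ (m + 2 * suc n)
    derivative = begin
      G m n ⊗ W (odd (suc m)) (odd (suc n))       ≈⟨ deriv-G m n ⟨
      deriv (G (suc m) (suc n))                    ≈⟨ deriv-cong e ⟩
      deriv (one ⊕ X ^ᵖ suc (m + 2 * suc n))       ≈⟨ deriv-1⊕X^ (m + 2 * suc n) ⟩
      C (odd (suc m + 2 * suc n)) ⊗ X ^ᵖ (m + 2 * suc n)
        ≡⟨ cong (λ β → C β ⊗ X ^ᵖ (m + 2 * suc n)) (odd-+-2* (suc m) (suc n)) ⟩
      C (odd (suc m)) ⊗ X ^ᵖ (m + 2 * suc n)       ∎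
    by-parity-of-m : ∀ μ → odd (suc m) ≡ μ → SamePowerOfTwo (suc m) (suc n)
    by-parity-of-m true odd-m = 0 , cong suc (proj₁ m,n≡0) , cong suc (proj₂ m,n≡0)
      where
      m,n≡0 : m ≡ 0 × n ≡ 0
      m,n≡0 = powers-of-two-odd-case m n
        (subst (λ μ → G m n ⊗ W μ (odd (suc n)) ≋ C μ ⊗ X ^ᵖ (m + 2 * suc n)) odd-m derivative)
    by-parity-of-m false odd-m =
      from-halves (even⇒double (suc m) odd-m)
                  (even⇒double (suc n) (proj₂ (⊗W-zero {G m n} (ev0-G m n) cofactor≋0)))
      where
      cofactor≋0 : G m n ⊗ W (odd (suc m)) (odd (suc n)) ≋ []
      cofactor≋0 = ≋-trans derivative (⊗-zeroˡ (X ^ᵖ (m + 2 * suc n)) (C-false odd-m))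
      from-halves : (Σ ℕ λ k → suc m ≡ k + k) → (Σ ℕ λ l → suc n ≡ l + l) →
                    SamePowerOfTwo (suc m) (suc n)
      from-halves (zero , ()) _
      from-halves (suc k , _) (zero , ())
      from-halves (suc k , m≡) (suc l , n≡) = doubled
        (rec (subst (suc k <_) (sym m≡) (m<m+n (suc k) (s≤s z≤n))) (suc l) (s≤s z≤n) (s≤s z≤n)
             (halve-exponents (suc k) (suc l) (subst₂ (λ m′ n′ → G m′ n′ ≋ one ⊕ X ^ᵖ (m′ + 2 * n′)) m≡ n≡ e)))
        where
        doubled : SamePowerOfTwo (suc k) (suc l) → SamePowerOfTwo (suc m) (suc n)
        doubled (t , k≡ , l≡) = suc t , trans m≡ (double-power t k≡) , trans n≡ (double-power t l≡)

G-absorb-1⊕X : ∀ b c → (one ⊕ X ^ᵖ 1) ⊗ G b c ≋ G (suc b) c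
G-absorb-1⊕X b c = ≋-sym (≋-trans (⊗-assoc x+1 (x+1 ^ᵖ b) (Q ^ᵖ c))
                                 (⊗-congˡ (G b c) (≈⇒≋ {x+1} {one ⊕ X ^ᵖ 1} refl)))

G-absorb-1⊕X³ : ∀ b c → (one ⊕ X ^ᵖ 3) ⊗ G b c ≋ G (suc b) (suc c)
G-absorb-1⊕X³ b c = begin
  (one ⊕ X ^ᵖ 3) ⊗ G b c   ≈⟨ ⊗-congˡ (G b c) (≈⇒≋ {one ⊕ X ^ᵖ 3} {x+1 ⊗ Q} refl) ⟩
  (x+1 ⊗ Q) ⊗ G b c        ≈⟨ ⊗-comm (x+1 ⊗ Q) (G b c) ⟩
  G b c ⊗ (x+1 ⊗ Q)        ≈⟨ G-suc b c ⟨
  G (suc b) (suc c)        ∎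
  where open ≋-Reasoning

ExceptionalExponents : ℕ → ℕ → ℕ → Set
ExceptionalExponents a b c = Σ ℕ (λ n → ((a ≡ 1) × (b ≡ 2 ^ n ∸ 1) × (c ≡ 2 ^ n))
                                      ⊎ ((a ≡ 3) × (b ≡ 2 ^ n ∸ 1) × (c ≡ 2 ^ n ∸ 1)))

exceptional-exponents : ∀ a b c →
  (one ⊕ X ^ᵖ suc a) ⊗ G (suc b) (suc c) ≋ one ⊕ X ^ᵖ (suc a + suc b + 2 * suc c) →
  a ≡ 0 ⊎ a ≡ 2 → ExceptionalExponents (suc a) (suc b) (suc c)
exceptional-exponents _ b c e (inj₁ refl) = conclude
  (powers-of-two (suc (suc b)) (suc c) (s≤s z≤n) (s≤s z≤n) (≋-trans (≋-sym (G-absorb-1⊕X (suc b) (suc c))) e))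
  where
  conclude : SamePowerOfTwo (suc (suc b)) (suc c) → ExceptionalExponents 1 (suc b) (suc c)
  conclude (t , b+1≡ , c≡) = t , inj₁ (refl , cong (_∸ 1) b+1≡ , c≡)
exceptional-exponents _ b c e (inj₂ refl) = conclude
  (powers-of-two (suc (suc b)) (suc (suc c)) (s≤s z≤n) (s≤s z≤n)
    (≋-trans (≋-sym (G-absorb-1⊕X³ (suc b) (suc c))) (≋-trans e (≋-reflexive (cong (λ N → one ⊕ X ^ᵖ N) (regroup b c))))))
  where
  regroup : ∀ b c → 3 + suc b + 2 * suc c ≡ suc (suc b) + 2 * suc (suc c)
  regroup = solve-∀
  conclude : SamePowerOfTwo (suc (suc b)) (suc (suc c)) → ExceptionalExponents 3 (suc b) (suc c)
  conclude (t , b+1≡ , c+1≡) = t , inj₂ (refl , cong (_∸ 1) b+1≡ , cong (_∸ 1) c+1≡)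

proposition3p15 : (a b c : ℕ) → 1 ≤ a → 1 ≤ b → 1 ≤ c →
    Irreducible (Qabc a b c) → reciprocal (Qabc a b c) ≈ Qabc a b c →
    Σ ℕ (λ n → ((a ≡ 1) × (b ≡ 2 ^ n ∸ 1) × (c ≡ 2 ^ n))
             ⊎ ((a ≡ 3) × (b ≡ 2 ^ n ∸ 1) × (c ≡ 2 ^ n ∸ 1)))
proposition3p15 (suc a) (suc b) (suc c) 1≤a _ _ irreducible self-reciprocal =
  [ (λ all-even → ⊥-elim (all-even⇒reducible (suc a) (suc b) (suc c) 1≤a all-even irreducible))
  , exceptional-exponents a b c identity
  ]′ (self-reciprocal-cases a b c (suc a + suc b + 2 * suc c) identity)
  where
  identity : (one ⊕ X ^ᵖ suc a) ⊗ G (suc b) (suc c) ≋ one ⊕ X ^ᵖ (suc a + suc b + 2 * suc c)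
  identity = self-reciprocal-Qabc (suc a) (suc b) (suc c) 1≤a self-reciprocal
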